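{- In every nested SQS$(v)$, at least one ND-pair has multiplicity at most $\frac{v-1}{3}$.
   Context: A Steiner quadruple system SQS$(v)$ is a pair $(Q,\mathcal{B})$ where $Q$ is a set of $v$ points and $\mathcal{B}$ is a collection of 4-subsets of $Q$ (blocks) such that every 3-subset of $Q$ is contained in exactly one block. A nested SQS$(v)$ is an SQS$(v)$ together with a partition of each block into two 2-subsets (pairs). A pair of points is an ND-pair if it is one of the two pairs in the partition of at least one block; the multiplicity of a pair is the number of blocks whose partition contains that pair. -}

module Defs where

open import Data.Nat using (ℕ; _≤_; _∸_; _*_)
open import Data.Fin using (Fin)
open import Data.Fin.Properties using () renaming (_≟_ to _≟ᶠ_)
open import Data.List using (List; []; _∷_; length; filter)
open import Data.List.Membership.Propositional using (_∈_)
import Data.List.Membership.DecPropositional as DecMem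
open import Data.Product using (_×_; _,_; ∃-syntax)
open import Data.Sum using (_⊎_)
open import Relation.Nullary using (¬_; Dec)
open import Relation.Nullary.Decidable using (_×-dec_; _⊎-dec_)
open import Relation.Binary.PropositionalEquality using (_≡_; _≢_)

-- A nested block on the point set Fin v: four distinct points a b c d,
-- i.e. the block {a,b,c,d} together with its partition into the pairs
-- {a,b} and {c,d}.
record NBlock (v : ℕ) : Set where
  constructor nblock
  field
    a b c d : Fin v
    a≢b : a ≢ b
    a≢c : a ≢ c
    a≢d : a ≢ d
    b≢c : b ≢ c
    b≢d : b ≢ d
    c≢d : c ≢ d

open NBlock public

points : ∀ {v} → NBlock v → List (Fin v)
points B = a B ∷ b B ∷ c B ∷ d B ∷ []

ContainsTriple : ∀ {v} → Fin v → Fin v → Fin v → NBlock v → Set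
ContainsTriple x y z B = (x ∈ points B) × (y ∈ points B) × (z ∈ points B)

containsTriple? : ∀ {v} (x y z : Fin v) (B : NBlock v) → Dec (ContainsTriple x y z B)
containsTriple? {v} x y z B = (x ∈? points B) ×-dec ((y ∈? points B) ×-dec (z ∈? points B))
  where open DecMem (_≟ᶠ_ {v}) using (_∈?_)

SamePair : ∀ {v} → Fin v → Fin v → Fin v → Fin v → Set
SamePair x y p q = ((x ≡ p) × (y ≡ q)) ⊎ ((x ≡ q) × (y ≡ p))

samePair? : ∀ {v} (x y p q : Fin v) → Dec (SamePair x y p q)
samePair? x y p q = ((x ≟ᶠ p) ×-dec (y ≟ᶠ q)) ⊎-dec ((x ≟ᶠ q) ×-dec (y ≟ᶠ p))

PairOf : ∀ {v} → Fin v → Fin v → NBlock v → Set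
PairOf x y B = SamePair x y (a B) (b B) ⊎ SamePair x y (c B) (d B)

pairOf? : ∀ {v} (x y : Fin v) (B : NBlock v) → Dec (PairOf x y B)
pairOf? x y B = samePair? x y (a B) (b B) ⊎-dec samePair? x y (c B) (d B)

IsNestedSQS : (v : ℕ) → List (NBlock v) → Set
IsNestedSQS v Bs =
  ∀ (x y z : Fin v) → x ≢ y → x ≢ z → y ≢ z →
    length (filter (containsTriple? x y z) Bs) ≡ 1

multiplicity : ∀ {v} → List (NBlock v) → Fin v → Fin v → ℕ
multiplicity Bs x y = length (filter (pairOf? x y) Bs)

IsNDPair : ∀ {v} → List (NBlock v) → Fin v → Fin v → Set
IsNDPair Bs x y = (x ≢ y) × (1 ≤ multiplicity Bs x y)

-- Fix a point x and write v = 2 + n. Counting triples shows that every other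
-- point lies in n/2 blocks together with x and that x lies in r = (n+1)n/6
-- blocks; since every block through x pairs x with exactly one partner, the
-- multiplicities of the ND-pairs at x add up to r. If some z ≠ x is not a
-- partner of x, the n/2 blocks through x and z pair x with n/2 distinct
-- partners (two of them with a common partner y would both contain {x,y,z});
-- otherwise all v - 1 other points are partners. So x has s ≥ n/2 partners,
-- and if every ND-pair at x had multiplicity at least v/3 we would get
-- v n ≤ 2 v s ≤ 6 r = (v - 1) n, which is absurd.
module Submission where

open import Defs
open import Data.Bool.Base using (true; false; if_then_else_)
open import Data.Empty using (⊥-elim)
open import Data.Fin.Base using (Fin; zero; suc; punchIn; punchOut)
open import Data.Fin.Properties using (any?; punchInᵢ≢i; punchIn-injective; punchIn-punchOut)
  renaming (_≟_ to _≟ᶠ_)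
open import Data.List.Base using (List; []; _∷_; length; filter; lookup; map)
open import Data.List.Membership.Propositional using (_∈_; _∉_)
import Data.List.Membership.DecPropositional as DecMembership
open import Data.List.Relation.Unary.Any using (here; there)
open import Data.List.Relation.Unary.All using ([]; _∷_; universal)
open import Data.List.Properties using (filter-none)
open import Data.List.Relation.Unary.All.Properties using (All¬⇒¬Any)
open import Data.List.Relation.Unary.AllPairs using ([]; _∷_)
open import Data.List.Relation.Unary.Unique.Propositional using (Unique)
open import Data.Nat.Base using (ℕ; zero; suc; _+_; _*_; _∸_; _≤_; z≤n; s≤s; NonZero)
open import Data.Nat.ListAction as List using ()
open import Data.Nat.Properties
open import Data.Nat.Tactic.RingSolver using (solve-∀)
open import Algebra.Properties.Semiring.Sum +-*-semiring
  using (sum; sum-syntax; sum-cong-≗; sum-remove; sum-replicate-zero; ∑-comm; ∑-distrib-+; *-distribˡ-sum; *-distribʳ-sum)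
open import Data.Product.Base using (_×_; _,_; ∃-syntax)
open import Data.Sum.Base using (inj₁; inj₂)
open import Function.Base using (_∘_)
open import Relation.Nullary using (¬_; Dec; yes; no; does; ¬?)
open import Relation.Nullary.Decidable using (_×-dec_; _⊎-dec_; dec-true; dec-false)
open import Relation.Unary using (Decidable)
open import Relation.Binary.PropositionalEquality

𝟙 : ∀ {p} {P : Set p} → Dec P → ℕ
𝟙 P? = if does P? then 1 else 0

module _ {p} {P : Set p} where

  𝟙-yes : (P? : Dec P) → P → 𝟙 P? ≡ 1
  𝟙-yes P? x rewrite dec-true P? x = refl

  𝟙-no : (P? : Dec P) → ¬ P → 𝟙 P? ≡ 0
  𝟙-no P? ¬x rewrite dec-false P? ¬x = refl

  m*𝟙≤m : ∀ m (P? : Dec P) → m * 𝟙 P? ≤ m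
  m*𝟙≤m m (yes _) = ≤-reflexive (*-identityʳ m)
  m*𝟙≤m m (no _)  = ≤-trans (≤-reflexive (*-zeroʳ m)) z≤n

  𝟙-idem : (P? : Dec P) → 𝟙 P? * 𝟙 P? ≡ 𝟙 P?
  𝟙-idem (yes _) = refl
  𝟙-idem (no _)  = refl

module _ {p q} {P : Set p} {Q : Set q} where

  𝟙-mono : (P → Q) → (P? : Dec P) (Q? : Dec Q) → 𝟙 P? ≤ 𝟙 Q?
  𝟙-mono P⇒Q (yes x) Q? = ≤-reflexive (sym (𝟙-yes Q? (P⇒Q x)))
  𝟙-mono P⇒Q (no _)  Q? = z≤n

  𝟙-× : (P? : Dec P) (Q? : Dec Q) → 𝟙 (P? ×-dec Q?) ≡ 𝟙 P? * 𝟙 Q?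
  𝟙-× (yes _) (yes _) = refl
  𝟙-× (yes _) (no _)  = refl
  𝟙-× (no _)  _       = refl

  𝟙-⊎ : ¬ (P × Q) → (P? : Dec P) (Q? : Dec Q) → 𝟙 (P? ⊎-dec Q?) ≡ 𝟙 P? + 𝟙 Q?
  𝟙-⊎ disjoint (yes x) (yes y) = ⊥-elim (disjoint (x , y))
  𝟙-⊎ disjoint (yes _) (no _)  = refl
  𝟙-⊎ disjoint (no _)  (yes _) = refl
  𝟙-⊎ disjoint (no _)  (no _)  = refl

∑-mono-≤ : ∀ {n} {f g : Fin n → ℕ} → (∀ i → f i ≤ g i) → ∑[ i < n ] f i ≤ ∑[ i < n ] g i
∑-mono-≤ {zero}  f≤g = z≤n
∑-mono-≤ {suc n} f≤g = +-mono-≤ (f≤g zero) (∑-mono-≤ (λ i → f≤g (suc i)))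

∑-const : ∀ n c → ∑[ i < n ] c ≡ n * c
∑-const zero    c = refl
∑-const (suc n) c = cong (c +_) (∑-const n c)

∑-except₁ : ∀ {m c} {f : Fin (suc m) → ℕ} p → (∀ w → w ≢ p → f w ≡ c) →
            ∑[ w < suc m ] f w ≡ f p + m * c
∑-except₁ {m} {c} {f} p f≡c = begin
  sum f                          ≡⟨ sum-remove {i = p} f ⟩
  f p + ∑[ j < m ] f (punchIn p j) ≡⟨ cong (f p +_) (sum-cong-≗ (λ j → f≡c (punchIn p j) (punchInᵢ≢i p j))) ⟩
  f p + ∑[ j < m ] c             ≡⟨ cong (f p +_) (∑-const m c) ⟩
  f p + m * c                    ∎
  where open ≡-Reasoning

∑-except₂ : ∀ {m c} {f : Fin (suc (suc m)) → ℕ} {p q} → p ≢ q →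
            (∀ w → w ≢ p → w ≢ q → f w ≡ c) → ∑[ w < suc (suc m) ] f w ≡ f p + (f q + m * c)
∑-except₂ {m} {c} {f} {p} {q} p≢q f≡c = begin
  sum f                               ≡⟨ sum-remove {i = p} f ⟩
  f p + ∑[ j < suc m ] f (punchIn p j) ≡⟨ cong (f p +_) (∑-except₁ q′ f∘punchIn≡c) ⟩
  f p + (f (punchIn p q′) + m * c)     ≡⟨ cong (λ w → f p + (f w + m * c)) (punchIn-punchOut p≢q) ⟩
  f p + (f q + m * c)                  ∎
  where
  open ≡-Reasoning
  q′ : Fin (suc m)
  q′ = punchOut p≢q
  f∘punchIn≡c : ∀ j → j ≢ q′ → f (punchIn p j) ≡ c
  f∘punchIn≡c j j≢q′ = f≡c (punchIn p j) (punchInᵢ≢i p j) λ eq →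
    j≢q′ (punchIn-injective p j q′ (trans eq (sym (punchIn-punchOut p≢q))))

∑-δ : ∀ {n} (p : Fin n) → ∑[ w < n ] 𝟙 (w ≟ᶠ p) ≡ 1
∑-δ {suc m} p = begin
  ∑[ w < suc m ] 𝟙 (w ≟ᶠ p) ≡⟨ ∑-except₁ p (λ w → 𝟙-no (w ≟ᶠ p)) ⟩
  𝟙 (p ≟ᶠ p) + m * 0        ≡⟨ cong₂ _+_ (𝟙-yes (p ≟ᶠ p) refl) (*-zeroʳ m) ⟩
  1                         ∎
  where open ≡-Reasoning

∑-support-bound : ∀ {n c} (f g : Fin n → ℕ) → (∀ i → 1 ≤ f i → c ≤ g i) →
                  c * ∑[ i < n ] 𝟙 (1 ≤? f i) ≤ ∑[ i < n ] g i
∑-support-bound {n} {c} f g bound = begin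
  c * ∑[ i < n ] 𝟙 (1 ≤? f i)   ≡⟨ *-distribˡ-sum {n} c (λ i → 𝟙 (1 ≤? f i)) ⟩
  ∑[ i < n ] (c * 𝟙 (1 ≤? f i)) ≤⟨ ∑-mono-≤ (λ i → pointwise i (1 ≤? f i)) ⟩
  ∑[ i < n ] g i                ∎
  where
  open ≤-Reasoning
  pointwise : ∀ i (d : Dec (1 ≤ f i)) → c * 𝟙 d ≤ g i
  pointwise i (yes 1≤fi) = ≤-trans (≤-reflexive (*-identityʳ c)) (bound i 1≤fi)
  pointwise i (no _)     = ≤-trans (≤-reflexive (*-zeroʳ c)) z≤n

length-filter≡∑𝟙 : ∀ {a p} {A : Set a} {P : A → Set p} (P? : Decidable P) (xs : List A) →
                length (filter P? xs) ≡ ∑[ i < length xs ] 𝟙 (P? (lookup xs i))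
length-filter≡∑𝟙 P? []       = refl
length-filter≡∑𝟙 P? (x ∷ xs) with does (P? x)
... | true  = cong suc (length-filter≡∑𝟙 P? xs)
... | false = length-filter≡∑𝟙 P? xs

module _ {n : ℕ} where
  open DecMembership (_≟ᶠ_ {n}) using (_∈?_)

  𝟙-∈-∷ : ∀ {p : Fin n} {xs} w → p ∉ xs → 𝟙 (w ∈? p ∷ xs) ≡ 𝟙 (w ≟ᶠ p) + 𝟙 (w ∈? xs)
  𝟙-∈-∷ w p∉xs = 𝟙-⊎ (λ { (refl , w∈xs) → p∉xs w∈xs }) (w ≟ᶠ _) (w ∈? _)

  𝟙-∈-unique : ∀ {xs} w → Unique xs → 𝟙 (w ∈? xs) ≡ List.sum (map (λ p → 𝟙 (w ≟ᶠ p)) xs)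
  𝟙-∈-unique w []                   = refl
  𝟙-∈-unique w (p≢xs ∷ unique-xs) =
    trans (𝟙-∈-∷ w (All¬⇒¬Any p≢xs)) (cong (𝟙 (w ≟ᶠ _) +_) (𝟙-∈-unique w unique-xs))

  ∑-𝟙-∈ : ∀ {xs} → Unique xs → ∑[ w < n ] 𝟙 (w ∈? xs) ≡ length xs
  ∑-𝟙-∈ []                             = sum-replicate-zero n
  ∑-𝟙-∈ {p ∷ xs} (p≢xs ∷ unique-xs) = begin
    ∑[ w < n ] 𝟙 (w ∈? p ∷ xs)                    ≡⟨ sum-cong-≗ (λ w → 𝟙-∈-∷ w (All¬⇒¬Any p≢xs)) ⟩
    ∑[ w < n ] (𝟙 (w ≟ᶠ p) + 𝟙 (w ∈? xs))          ≡⟨ ∑-distrib-+ (λ w → 𝟙 (w ≟ᶠ p)) (λ w → 𝟙 (w ∈? xs)) ⟩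
    ∑[ w < n ] 𝟙 (w ≟ᶠ p) + ∑[ w < n ] 𝟙 (w ∈? xs) ≡⟨ cong₂ _+_ (∑-δ p) (∑-𝟙-∈ unique-xs) ⟩
    suc (length xs)                               ∎
    where open ≡-Reasoning

module _ {v : ℕ} where
  open DecMembership (_≟ᶠ_ {v}) using (_∈?_)

  inc : Fin v → NBlock v → ℕ
  inc w B = 𝟙 (w ∈? points B)

  pairInc : Fin v → Fin v → NBlock v → ℕ
  pairInc x y B = 𝟙 (pairOf? x y B)

  points-unique : (B : NBlock v) → Unique (points B)
  points-unique B = (a≢b B ∷ a≢c B ∷ a≢d B ∷ []) ∷ (b≢c B ∷ b≢d B ∷ []) ∷ (c≢d B ∷ []) ∷ [] ∷ []

  ∑-inc : (B : NBlock v) → ∑[ w < v ] inc w B ≡ 4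
  ∑-inc B = ∑-𝟙-∈ (points-unique B)

  PairOf⇒∈ : ∀ {x y} (B : NBlock v) → PairOf x y B → x ∈ points B × y ∈ points B
  PairOf⇒∈ B (inj₁ (inj₁ (refl , refl))) = here refl , there (here refl)
  PairOf⇒∈ B (inj₁ (inj₂ (refl , refl))) = there (here refl) , here refl
  PairOf⇒∈ B (inj₂ (inj₁ (refl , refl))) = there (there (here refl)) , there (there (there (here refl)))
  PairOf⇒∈ B (inj₂ (inj₂ (refl , refl))) = there (there (there (here refl))) , there (there (here refl))

  pairInc≤inc*inc : ∀ x y B → pairInc x y B ≤ inc x B * inc y B
  pairInc≤inc*inc x y B = ≤-trans (𝟙-mono (PairOf⇒∈ B) (pairOf? x y B) ((x ∈? points B) ×-dec (y ∈? points B)))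
                                  (≤-reflexive (𝟙-× (x ∈? points B) (y ∈? points B)))

  PairOf-irrefl : ∀ {x} (B : NBlock v) → ¬ PairOf x x B
  PairOf-irrefl B (inj₁ (inj₁ (refl , x≡b))) = a≢b B x≡b
  PairOf-irrefl B (inj₁ (inj₂ (refl , x≡a))) = a≢b B (sym x≡a)
  PairOf-irrefl B (inj₂ (inj₁ (refl , x≡d))) = c≢d B x≡d
  PairOf-irrefl B (inj₂ (inj₂ (refl , x≡c))) = c≢d B (sym x≡c)

  𝟙-samePair : ∀ {p q : Fin v} x y → p ≢ q →
               𝟙 (samePair? x y p q) ≡ 𝟙 (x ≟ᶠ p) * 𝟙 (y ≟ᶠ q) + 𝟙 (x ≟ᶠ q) * 𝟙 (y ≟ᶠ p)
  𝟙-samePair {p} {q} x y p≢q = begin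
    𝟙 (samePair? x y p q)                                              ≡⟨ 𝟙-⊎ disjoint ((x ≟ᶠ p) ×-dec (y ≟ᶠ q)) ((x ≟ᶠ q) ×-dec (y ≟ᶠ p)) ⟩
    𝟙 ((x ≟ᶠ p) ×-dec (y ≟ᶠ q)) + 𝟙 ((x ≟ᶠ q) ×-dec (y ≟ᶠ p))           ≡⟨ cong₂ _+_ (𝟙-× (x ≟ᶠ p) (y ≟ᶠ q)) (𝟙-× (x ≟ᶠ q) (y ≟ᶠ p)) ⟩
    𝟙 (x ≟ᶠ p) * 𝟙 (y ≟ᶠ q) + 𝟙 (x ≟ᶠ q) * 𝟙 (y ≟ᶠ p)                   ∎
    where
    open ≡-Reasoning
    disjoint : ¬ ((x ≡ p × y ≡ q) × (x ≡ q × y ≡ p))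
    disjoint ((refl , _) , (x≡q , _)) = p≢q x≡q

  ∑-samePair : ∀ {p q : Fin v} x → p ≢ q → ∑[ y < v ] 𝟙 (samePair? x y p q) ≡ 𝟙 (x ≟ᶠ p) + 𝟙 (x ≟ᶠ q)
  ∑-samePair {p} {q} x p≢q = begin
    ∑[ y < v ] 𝟙 (samePair? x y p q)
      ≡⟨ sum-cong-≗ {v} (λ y → 𝟙-samePair x y p≢q) ⟩
    ∑[ y < v ] (δxp * 𝟙 (y ≟ᶠ q) + δxq * 𝟙 (y ≟ᶠ p))
      ≡⟨ ∑-distrib-+ (λ y → δxp * 𝟙 (y ≟ᶠ q)) (λ y → δxq * 𝟙 (y ≟ᶠ p)) ⟩
    ∑[ y < v ] (δxp * 𝟙 (y ≟ᶠ q)) + ∑[ y < v ] (δxq * 𝟙 (y ≟ᶠ p))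
      ≡⟨ cong₂ _+_ (*-distribˡ-sum δxp (λ y → 𝟙 (y ≟ᶠ q))) (*-distribˡ-sum δxq (λ y → 𝟙 (y ≟ᶠ p))) ⟨
    δxp * ∑[ y < v ] 𝟙 (y ≟ᶠ q) + δxq * ∑[ y < v ] 𝟙 (y ≟ᶠ p)
      ≡⟨ cong₂ _+_ (cong (δxp *_) (∑-δ q)) (cong (δxq *_) (∑-δ p)) ⟩
    δxp * 1 + δxq * 1
      ≡⟨ cong₂ _+_ (*-identityʳ δxp) (*-identityʳ δxq) ⟩
    δxp + δxq ∎
    where
    open ≡-Reasoning
    δxp = 𝟙 (x ≟ᶠ p)
    δxq = 𝟙 (x ≟ᶠ q)

  pairInc-split : ∀ x y B → pairInc x y B ≡ 𝟙 (samePair? x y (a B) (b B)) + 𝟙 (samePair? x y (c B) (d B))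
  pairInc-split x y B = 𝟙-⊎ disjoint (samePair? x y (a B) (b B)) (samePair? x y (c B) (d B))
    where
    disjoint : ¬ (SamePair x y (a B) (b B) × SamePair x y (c B) (d B))
    disjoint (inj₁ (refl , _) , inj₁ (x≡c , _)) = a≢c B x≡c
    disjoint (inj₁ (refl , _) , inj₂ (x≡d , _)) = a≢d B x≡d
    disjoint (inj₂ (refl , _) , inj₁ (x≡c , _)) = b≢c B x≡c
    disjoint (inj₂ (refl , _) , inj₂ (x≡d , _)) = b≢d B x≡d

  ∑-pairInc : ∀ x B → ∑[ y < v ] pairInc x y B ≡ inc x B
  ∑-pairInc x B = begin
    ∑[ y < v ] pairInc x y B
      ≡⟨ sum-cong-≗ {v} (λ y → pairInc-split x y B) ⟩
    ∑[ y < v ] (𝟙 (samePair? x y (a B) (b B)) + 𝟙 (samePair? x y (c B) (d B)))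
      ≡⟨ ∑-distrib-+ (λ y → 𝟙 (samePair? x y (a B) (b B))) (λ y → 𝟙 (samePair? x y (c B) (d B))) ⟩
    ∑[ y < v ] 𝟙 (samePair? x y (a B) (b B)) + ∑[ y < v ] 𝟙 (samePair? x y (c B) (d B))
      ≡⟨ cong₂ _+_ (∑-samePair x (a≢b B)) (∑-samePair x (c≢d B)) ⟩
    (δ (a B) + δ (b B)) + (δ (c B) + δ (d B))
      ≡⟨ +-assoc (δ (a B)) (δ (b B)) _ ⟩
    δ (a B) + (δ (b B) + (δ (c B) + δ (d B)))
      ≡⟨ cong (λ t → δ (a B) + (δ (b B) + (δ (c B) + t))) (+-identityʳ (δ (d B))) ⟨
    δ (a B) + (δ (b B) + (δ (c B) + (δ (d B) + 0)))
      ≡⟨ 𝟙-∈-unique x (points-unique B) ⟨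
    inc x B ∎
    where
    open ≡-Reasoning
    δ : Fin v → ℕ
    δ p = 𝟙 (x ≟ᶠ p)

  𝟙-containsTriple : ∀ x y z B → 𝟙 (containsTriple? x y z B) ≡ inc x B * (inc y B * inc z B)
  𝟙-containsTriple x y z B = begin
    𝟙 ((x ∈? points B) ×-dec ((y ∈? points B) ×-dec (z ∈? points B)))
      ≡⟨ 𝟙-× (x ∈? points B) ((y ∈? points B) ×-dec (z ∈? points B)) ⟩
    inc x B * 𝟙 ((y ∈? points B) ×-dec (z ∈? points B))
      ≡⟨ cong (inc x B *_) (𝟙-× (y ∈? points B) (z ∈? points B)) ⟩
    inc x B * (inc y B * inc z B) ∎
    where open ≡-Reasoning

  multiplicity-self : ∀ (Bs : List (NBlock v)) x → multiplicity Bs x x ≡ 0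
  multiplicity-self Bs x = cong length (filter-none (pairOf? x x) (universal PairOf-irrefl Bs))

  ND-pair-distinct : ∀ (Bs : List (NBlock v)) {x y} → 1 ≤ multiplicity Bs x y → x ≢ y
  ND-pair-distinct Bs {x} 1≤m refl = <-irrefl (sym (multiplicity-self Bs x)) 1≤m

-- The number of points is written 2 + n so that the counting identities below
-- need no truncated subtraction.
module NestedSQS {n : ℕ} (Bs : List (NBlock (2 + n))) (sqs : IsNestedSQS (2 + n) Bs) where

  open DecMembership (_≟ᶠ_ {2 + n}) using (_∈?_)

  Point : Set
  Point = Fin (2 + n)

  -- Blocks are summed over their positions in the list, so a repeated block
  -- counts with its multiplicity, as it does in filter-based definitions.
  ∑ᴮ : (NBlock (2 + n) → ℕ) → ℕ
  ∑ᴮ f = ∑[ i < length Bs ] f (lookup Bs i)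

  replication : Point → ℕ
  replication x = ∑ᴮ (inc x)

  pairReplication : Point → Point → ℕ
  pairReplication x z = ∑ᴮ (λ B → inc x B * inc z B)

  partners : Point → ℕ
  partners x = ∑[ y < 2 + n ] 𝟙 (1 ≤? multiplicity Bs x y)

  multiplicity≡∑ᴮ : ∀ x y → multiplicity Bs x y ≡ ∑ᴮ (pairInc x y)
  multiplicity≡∑ᴮ x y = length-filter≡∑𝟙 (pairOf? x y) Bs

  ∑ᴮ-triple : ∀ {x y z} → x ≢ y → x ≢ z → y ≢ z → ∑ᴮ (λ B → inc x B * (inc y B * inc z B)) ≡ 1
  ∑ᴮ-triple {x} {y} {z} x≢y x≢z y≢z = begin
    ∑ᴮ (λ B → inc x B * (inc y B * inc z B))       ≡⟨ sum-cong-≗ (λ i → 𝟙-containsTriple x y z (lookup Bs i)) ⟨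
    ∑ᴮ (λ B → 𝟙 (containsTriple? x y z B))         ≡⟨ length-filter≡∑𝟙 (containsTriple? x y z) Bs ⟨
    length (filter (containsTriple? x y z) Bs)     ≡⟨ sqs x y z x≢y x≢z y≢z ⟩
    1                                              ∎
    where open ≡-Reasoning

  ∑-∑ᴮ-inc : ∀ g → ∑[ w < 2 + n ] ∑ᴮ (λ B → g B * inc w B) ≡ ∑ᴮ g * 4
  ∑-∑ᴮ-inc g = begin
    ∑[ w < 2 + n ] ∑ᴮ (λ B → g B * inc w B)
      ≡⟨ ∑-comm (λ w i → g (lookup Bs i) * inc w (lookup Bs i)) ⟩
    ∑ᴮ (λ B → ∑[ w < 2 + n ] (g B * inc w B))
      ≡⟨ sum-cong-≗ (λ i → *-distribˡ-sum (g (lookup Bs i)) (λ w → inc w (lookup Bs i))) ⟨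
    ∑ᴮ (λ B → g B * ∑[ w < 2 + n ] inc w B)
      ≡⟨ sum-cong-≗ (λ i → cong (g (lookup Bs i) *_) (∑-inc (lookup Bs i))) ⟩
    ∑ᴮ (λ B → g B * 4)
      ≡⟨ *-distribʳ-sum 4 (λ i → g (lookup Bs i)) ⟨
    ∑ᴮ g * 4 ∎
    where open ≡-Reasoning

  ∑-multiplicity : ∀ x → ∑[ y < 2 + n ] multiplicity Bs x y ≡ replication x
  ∑-multiplicity x = begin
    ∑[ y < 2 + n ] multiplicity Bs x y   ≡⟨ sum-cong-≗ (multiplicity≡∑ᴮ x) ⟩
    ∑[ y < 2 + n ] ∑ᴮ (pairInc x y)      ≡⟨ ∑-comm (λ y i → pairInc x y (lookup Bs i)) ⟩
    ∑ᴮ (λ B → ∑[ y < 2 + n ] pairInc x y B) ≡⟨ sum-cong-≗ (λ i → ∑-pairInc x (lookup Bs i)) ⟩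
    replication x                         ∎
    where open ≡-Reasoning

  -- Count the pairs (w, B) with x, z, w ∈ B: each block through x and z has four
  -- such points w, and every w other than x and z lies in exactly one of them.
  pairReplication-identity : ∀ {x z} → x ≢ z → pairReplication x z + pairReplication x z ≡ n
  pairReplication-identity {x} {z} x≢z = +-cancelˡ-≡ l _ _ (+-cancelˡ-≡ l _ _ (begin
    l + (l + (l + l))    ≡⟨ cong (λ t → l + (l + (l + t))) (+-identityʳ l) ⟨
    4 * l                ≡⟨ *-comm 4 l ⟩
    l * 4                ≡⟨ ∑-∑ᴮ-inc (λ B → inc x B * inc z B) ⟨
    ∑[ w < 2 + n ] g w   ≡⟨ ∑-except₂ x≢z g≡1 ⟩
    g x + (g z + n * 1)  ≡⟨ cong₂ (λ s t → s + (t + n * 1)) gx≡l gz≡l ⟩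
    l + (l + n * 1)      ≡⟨ cong (λ t → l + (l + t)) (*-identityʳ n) ⟩
    l + (l + n)          ∎))
    where
    open ≡-Reasoning
    l : ℕ
    l = pairReplication x z
    g : Point → ℕ
    g w = ∑ᴮ (λ B → inc x B * inc z B * inc w B)
    g≡1 : ∀ w → w ≢ x → w ≢ z → g w ≡ 1
    g≡1 w w≢x w≢z = trans (sum-cong-≗ (λ i → *-assoc (inc x (lookup Bs i)) _ _))
                          (∑ᴮ-triple x≢z (w≢x ∘ sym) (w≢z ∘ sym))
    gx≡l : g x ≡ l
    gx≡l = sum-cong-≗ λ i → let X = inc x (lookup Bs i); Z = inc z (lookup Bs i) in begin
      X * Z * X   ≡⟨ *-comm (X * Z) X ⟩
      X * (X * Z) ≡⟨ *-assoc X X Z ⟨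
      X * X * Z   ≡⟨ cong (_* Z) (𝟙-idem (x ∈? points (lookup Bs i))) ⟩
      X * Z       ∎
    gz≡l : g z ≡ l
    gz≡l = sum-cong-≗ λ i → let X = inc x (lookup Bs i); Z = inc z (lookup Bs i) in begin
      X * Z * Z   ≡⟨ *-assoc X Z Z ⟩
      X * (Z * Z) ≡⟨ cong (X *_) (𝟙-idem (z ∈? points (lookup Bs i))) ⟩
      X * Z       ∎

  pairReplication-self : ∀ x → pairReplication x x ≡ replication x
  pairReplication-self x = sum-cong-≗ (λ i → 𝟙-idem (x ∈? points (lookup Bs i)))

  replication-identity : ∀ x → 6 * replication x ≡ (1 + n) * n
  replication-identity x = +-cancelˡ-≡ (r + r) _ _ (begin
    r + r + 6 * r                   ≡⟨ regroup r ⟩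
    r * 4 + r * 4                   ≡⟨ cong₂ _+_ (∑-∑ᴮ-inc (inc x)) (∑-∑ᴮ-inc (inc x)) ⟨
    ∑[ z < 2 + n ] l z + ∑[ z < 2 + n ] l z  ≡⟨ ∑-distrib-+ l l ⟨
    ∑[ z < 2 + n ] (l z + l z)     ≡⟨ ∑-except₁ x (λ z z≢x → pairReplication-identity (z≢x ∘ sym)) ⟩
    l x + l x + (1 + n) * n         ≡⟨ cong (λ t → t + t + (1 + n) * n) (pairReplication-self x) ⟩
    r + r + (1 + n) * n             ∎)
    where
    open ≡-Reasoning
    r : ℕ
    r = replication x
    l : Point → ℕ
    l = pairReplication x
    regroup : ∀ r → r + r + 6 * r ≡ r * 4 + r * 4
    regroup = solve-∀

  -- Each block through x and z contributes its partner y of x, and a given y ≠ z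
  -- arises from at most one block, the one containing {x, y, z}.
  pairReplication≤partners : ∀ {x z} → x ≢ z → multiplicity Bs x z ≡ 0 → pairReplication x z ≤ partners x
  pairReplication≤partners {x} {z} x≢z mxz≡0 = begin
    ∑ᴮ (λ B → inc x B * inc z B)                    ≡⟨ sum-cong-≗ (λ i → cong (_* inc z (lookup Bs i)) (∑-pairInc x (lookup Bs i))) ⟨
    ∑ᴮ (λ B → ∑[ y < 2 + n ] pairInc x y B * inc z B) ≡⟨ sum-cong-≗ (λ i → *-distribʳ-sum (inc z (lookup Bs i)) (λ y → pairInc x y (lookup Bs i))) ⟩
    ∑ᴮ (λ B → ∑[ y < 2 + n ] (pairInc x y B * inc z B)) ≡⟨ ∑-comm (λ i y → pairInc x y (lookup Bs i) * inc z (lookup Bs i)) ⟩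
    ∑[ y < 2 + n ] ∑ᴮ (λ B → pairInc x y B * inc z B) ≤⟨ ∑-mono-≤ (λ y → through-y≤𝟙 y (1 ≤? multiplicity Bs x y)) ⟩
    partners x                                      ∎
    where
    open ≤-Reasoning
    through-y≤m : ∀ y → ∑ᴮ (λ B → pairInc x y B * inc z B) ≤ multiplicity Bs x y
    through-y≤m y = ≤-trans (∑-mono-≤ (λ i → m*𝟙≤m (pairInc x y (lookup Bs i)) (z ∈? points (lookup Bs i))))
                              (≤-reflexive (sym (multiplicity≡∑ᴮ x y)))
    through-y≤𝟙 : ∀ y (d : Dec (1 ≤ multiplicity Bs x y)) → ∑ᴮ (λ B → pairInc x y B * inc z B) ≤ 𝟙 d
    through-y≤𝟙 y (no 1≰m)  = ≤-trans (through-y≤m y) (≤-reflexive (n<1⇒n≡0 (≰⇒> 1≰m)))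
    through-y≤𝟙 y (yes 1≤m) = ≤-trans (∑-mono-≤ λ i → *-monoˡ-≤ (inc z (lookup Bs i)) (pairInc≤inc*inc x y (lookup Bs i)))
                         (≤-reflexive (trans (sum-cong-≗ (λ i → *-assoc (inc x (lookup Bs i)) _ _))
                                             (∑ᴮ-triple (ND-pair-distinct Bs 1≤m) x≢z y≢z)))
      where
      y≢z : y ≢ z
      y≢z refl = <-irrefl (sym mxz≡0) 1≤m

  n≤partners+partners : ∀ x → n ≤ partners x + partners x
  n≤partners+partners x with any? (λ z → ¬? (x ≟ᶠ z) ×-dec (multiplicity Bs x z ≟ 0))
  ... | yes (z , x≢z , mxz≡0) = begin
    n                                          ≡⟨ pairReplication-identity x≢z ⟨
    pairReplication x z + pairReplication x z  ≤⟨ +-mono-≤ p≤s p≤s ⟩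
    partners x + partners x                    ∎
    where
    open ≤-Reasoning
    p≤s : pairReplication x z ≤ partners x
    p≤s = pairReplication≤partners x≢z mxz≡0
  ... | no no-isolated = begin
    n                                          ≤⟨ n≤1+n n ⟩
    1 + n                                      ≡⟨ *-identityʳ (1 + n) ⟨
    (1 + n) * 1                                ≤⟨ m≤n+m _ _ ⟩
    𝟙 (1 ≤? multiplicity Bs x x) + (1 + n) * 1 ≡⟨ ∑-except₁ x partner ⟨
    partners x                                 ≤⟨ m≤m+n _ _ ⟩
    partners x + partners x                    ∎
    where
    open ≤-Reasoning
    partner : ∀ z → z ≢ x → 𝟙 (1 ≤? multiplicity Bs x z) ≡ 1
    partner z z≢x = 𝟙-yes (1 ≤? _) (n≢0⇒n>0 λ mxz≡0 → no-isolated (z , (z≢x ∘ sym) , mxz≡0))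

  partners-bound : ∀ {c} x → (∀ y → 1 ≤ multiplicity Bs x y → c ≤ 3 * multiplicity Bs x y) →
                   c * partners x ≤ 3 * replication x
  partners-bound {c} x large = begin
    c * partners x                                 ≤⟨ ∑-support-bound (multiplicity Bs x) (λ y → 3 * multiplicity Bs x y) large ⟩
    ∑[ y < 2 + n ] (3 * multiplicity Bs x y)       ≡⟨ *-distribˡ-sum 3 (multiplicity Bs x) ⟨
    3 * ∑[ y < 2 + n ] multiplicity Bs x y         ≡⟨ cong (3 *_) (∑-multiplicity x) ⟩
    3 * replication x                              ∎
    where open ≤-Reasoning

  no-large-multiplicities : .{{NonZero n}} → ∀ x →
                            ¬ (∀ y → 1 ≤ multiplicity Bs x y → 2 + n ≤ 3 * multiplicity Bs x y)
  no-large-multiplicities x large = <-irrefl refl (begin-strict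
    (2 + n) * n                        ≤⟨ *-monoʳ-≤ (2 + n) (n≤partners+partners x) ⟩
    (2 + n) * (s + s)                  ≡⟨ *-distribˡ-+ (2 + n) s s ⟩
    (2 + n) * s + (2 + n) * s          ≤⟨ +-mono-≤ bound bound ⟩
    3 * r + 3 * r                      ≡⟨ *-distribʳ-+ r 3 3 ⟨
    6 * r                              ≡⟨ replication-identity x ⟩
    (1 + n) * n                        <⟨ *-monoˡ-< n (n<1+n (1 + n)) ⟩
    (2 + n) * n                        ∎)
    where
    open ≤-Reasoning
    s r : ℕ
    s = partners x
    r = replication x
    bound : (2 + n) * s ≤ 3 * r
    bound = partners-bound x large

  small-ND-pair : .{{NonZero n}} → ∀ x → ∃[ y ] (IsNDPair Bs x y × 3 * multiplicity Bs x y ≤ 1 + n)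
  small-ND-pair x with any? (λ y → (1 ≤? multiplicity Bs x y) ×-dec (3 * multiplicity Bs x y ≤? 1 + n))
  ... | yes (y , 1≤m , small) = y , (ND-pair-distinct Bs 1≤m , 1≤m) , small
  ... | no none = ⊥-elim (no-large-multiplicities x λ y 1≤m → ≰⇒> (λ small → none (y , 1≤m , small)))

lemma2p9 : (v : ℕ) → 4 ≤ v → (Bs : List (NBlock v)) → IsNestedSQS v Bs →
    ∃[ x ] ∃[ y ] (IsNDPair Bs x y × 3 * multiplicity Bs x y ≤ v ∸ 1)
lemma2p9 (suc (suc (suc (suc k)))) (s≤s (s≤s (s≤s (s≤s z≤n)))) Bs sqs =
  zero , NestedSQS.small-ND-pair Bs sqs zero
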